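{- Fix a $k$-partition with sinks $\{\hat P,\hat Y\}$. There exists a worst-case scenario $s^*$ for $\{\hat P,\hat Y\}$, with dominant part $P_d$, such that the sub-scenario of $s^*$ within $P_d$ is left-dominant or right-dominant.
   Context: $P$ is a path with vertices at coordinates $x_0<\dots<x_n$; $\tau>0$. Vertex $x_i$ has weight interval $[w_i^-,w_i^+]$, $0<w_i^-\le w_i^+$; a scenario $s$ assigns $w_i(s)\in[w_i^-,w_i^+]$, and $\mathcal S$ is the set of scenarios. For a subpath $Q=\{x_l,\dots,x_r\}$, sink $y=x_t\in Q$: $\Theta_L(Q,y,s)=\max_{l\le i<t}\{(x_t-x_i)\tau+\sum_{j=l}^i w_j(s)\}$, $\Theta_R(Q,y,s)=\max_{t<i\le r}\{(x_i-x_t)\tau+\sum_{j=i}^r w_j(s)\}$ (empty maxima $0$), $\Theta^1=\max(\Theta_L,\Theta_R)$. A $k$-partition with sinks: consecutive subpaths $P_1,\dots,P_k$ partitioning the vertices with sinks $y_i\in P_i$. $\Theta^k(P,\{\hat P,\hat Y\},s)=\max_i\Theta^1(P_i,y_i,s)$; $\Theta^k_{\rm opt}(P,s)$ its minimum over all $k$-partitions with sinks; regret $=\Theta^k-\Theta^k_{\rm opt}$; a worst-case scenario maximizes regret over $\mathcal S$. The dominant part is $P_d$, $d$ the smallest index maximizing $\Theta^1(P_i,y_i,s)$. For a subpath $\{x_l,\dots,x_r\}$, the sub-scenario of $s$ on it is left-dominant (resp. right-dominant) if for some $i$ with $l\le i\le r$, $w_j(s)=w_j^+$ (resp. $w_j^-$)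 for $l\le j<i$ and $w_j(s)=w_j^-$ (resp. $w_j^+$) for $i\le j\le r$.
   Formalization: The vertex coordinates, τ, the interval endpoints $w_i^-$ and $w_i^+$, and the weights $w_i(s)$ of every scenario are all rational numbers. -}

module Defs where

open import Data.Nat as ℕ using (ℕ; zero; suc; _∸_)
open import Data.Fin using (Fin; toℕ)
open import Data.List using (List; []; _∷_; map; foldr; upTo; allFin)
open import Data.Rational using (ℚ; 0ℚ; _+_; _-_; _*_; _⊔_; _≤_; _<_)
open import Data.Product using (Σ; ∃; _×_; _,_)
open import Data.Sum using (_⊎_)
open import Relation.Binary.PropositionalEquality using (_≡_)

-- Vertices are indexed 0..n; coordinates, weights and scenarios are
-- functions ℕ → ℚ (only indices ≤ n are ever used).

-- Maximum of a list, with the convention that the empty maximum is 0.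
maxL : List ℚ → ℚ
maxL = foldr _⊔_ 0ℚ

-- Σ_{j=a}^{b} s j   (empty if b < a)
sumW : (ℕ → ℚ) → ℕ → ℕ → ℚ
sumW s a b = foldr _+_ 0ℚ (map (λ j → s (a ℕ.+ j)) (upTo (suc b ∸ a)))

-- Θ_L(Q,y,s) for Q = {x_l..x_r}, y = x_t : max over l ≤ i < t
ΘL : (x : ℕ → ℚ) (τ : ℚ) (s : ℕ → ℚ) (l r t : ℕ) → ℚ
ΘL x τ s l r t =
  maxL (map (λ j → let i = l ℕ.+ j in ((x t - x i) * τ) + sumW s l i) (upTo (t ∸ l)))

-- Θ_R(Q,y,s) : max over t < i ≤ r
ΘR : (x : ℕ → ℚ) (τ : ℚ) (s : ℕ → ℚ) (l r t : ℕ) → ℚ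
ΘR x τ s l r t =
  maxL (map (λ j → let i = suc t ℕ.+ j in ((x i - x t) * τ) + sumW s i r) (upTo (r ∸ t)))

Θ1 : (x : ℕ → ℚ) (τ : ℚ) (s : ℕ → ℚ) (l r t : ℕ) → ℚ
Θ1 x τ s l r t = ΘL x τ s l r t ⊔ ΘR x τ s l r t

record PathInstance (n : ℕ) : Set where
  field
    x     : ℕ → ℚ
    τ     : ℚ
    w⁻    : ℕ → ℚ
    w⁺    : ℕ → ℚ
    x-inc : ∀ i → i ℕ.< n → x i < x (suc i)
    τ-pos : 0ℚ < τ
    w⁻-pos : ∀ i → i ℕ.≤ n → 0ℚ < w⁻ i
    w⁻≤w⁺ : ∀ i → i ℕ.≤ n → w⁻ i ≤ w⁺ i

open PathInstance public

IsScenario : ∀ {n} → PathInstance n → (ℕ → ℚ) → Set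
IsScenario {n} P s = ∀ i → i ℕ.≤ n → (w⁻ P i ≤ s i) × (s i ≤ w⁺ P i)

-- A k-partition of {0..n} into consecutive subpaths P_i = {left i .. right i}
-- with sinks y_i = x_{sink i} ∈ P_i.
record KPartition (n k : ℕ) : Set where
  field
    left  : Fin k → ℕ
    right : Fin k → ℕ
    sink  : Fin k → ℕ
    k-pos : 1 ℕ.≤ k
    first : ∀ i → toℕ i ≡ 0 → left i ≡ 0
    last  : ∀ i → suc (toℕ i) ≡ k → right i ≡ n
    consec : ∀ i j → toℕ j ≡ suc (toℕ i) → left j ≡ suc (right i)
    sink-l : ∀ i → left i ℕ.≤ sink i
    sink-r : ∀ i → sink i ℕ.≤ right i

open KPartition public

ΘPart : ∀ {n k} → PathInstance n → KPartition n k → (ℕ → ℚ) → Fin k → ℚ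
ΘPart P Π s i = Θ1 (x P) (τ P) s (left Π i) (right Π i) (sink Π i)

Θk : ∀ {n k} → PathInstance n → KPartition n k → (ℕ → ℚ) → ℚ
Θk {k = k} P Π s = maxL (map (ΘPart P Π s) (allFin k))

IsOpt : ∀ {n} → PathInstance n → (k : ℕ) → (ℕ → ℚ) → ℚ → Set
IsOpt {n} P k s v =
  (Σ (KPartition n k) λ Π → Θk P Π s ≡ v) × (∀ (Π : KPartition n k) → v ≤ Θk P Π s)

IsRegret : ∀ {n k} → PathInstance n → KPartition n k → (ℕ → ℚ) → ℚ → Set
IsRegret {k = k} P Π s r = Σ ℚ λ v → IsOpt P k s v × (r ≡ Θk P Π s - v)

IsWorstCase : ∀ {n k} → PathInstance n → KPartition n k → (ℕ → ℚ) → Set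
IsWorstCase P Π s* =
  IsScenario P s* ×
  Σ ℚ λ r* → IsRegret P Π s* r* ×
    (∀ s → IsScenario P s → ∀ r → IsRegret P Π s r → r ≤ r*)

IsDominant : ∀ {n k} → PathInstance n → KPartition n k → (ℕ → ℚ) → Fin k → Set
IsDominant P Π s d =
  (∀ i → ΘPart P Π s i ≤ ΘPart P Π s d) ×
  (∀ i → toℕ i ℕ.< toℕ d → ΘPart P Π s i < ΘPart P Π s d)

LeftDominant : ∀ {n} → PathInstance n → (ℕ → ℚ) → ℕ → ℕ → Set
LeftDominant P s l r = Σ ℕ λ i → (l ℕ.≤ i) × (i ℕ.≤ r) ×
  (∀ j → l ℕ.≤ j → j ℕ.< i → s j ≡ w⁺ P j) ×
  (∀ j → i ℕ.≤ j → j ℕ.≤ r → s j ≡ w⁻ P j)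

RightDominant : ∀ {n} → PathInstance n → (ℕ → ℚ) → ℕ → ℕ → Set
RightDominant P s l r = Σ ℕ λ i → (l ℕ.≤ i) × (i ℕ.≤ r) ×
  (∀ j → l ℕ.≤ j → j ℕ.< i → s j ≡ w⁻ P j) ×
  (∀ j → i ℕ.≤ j → j ℕ.≤ r → s j ≡ w⁺ P j)

-- Let s be a scenario and [a, b] a subpath. The scenario that is w⁺ on [a, b] and
-- w⁻ elsewhere exceeds s by a total amount g on [a, b] and nowhere else, so every
-- weight sum, hence Θ^k of every partition and Θ^k_opt, grows by at most g, while
-- sums over [a, b] grow by exactly g. If [a, b] is the range of weights summed by
-- a term realising Θ^k(P, {P̂, Ŷ}, s), then Θ^k of the fixed partition grows by at
-- least g, so the regret does not decrease (and if Θ^k(s) = 0 the regret of s is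
-- already minimal). Such a range is a prefix [l, i] of a part ending before its
-- sink or a suffix [i, r] starting after it. Hence the finitely many scenarios
-- raised on such a block dominate all scenarios, the best of them is a worst case,
-- and on each part it is w⁺ on a prefix and w⁻ after it (left-dominant) or w⁻
-- before a suffix of w⁺ (right-dominant).
module Submission where

open import Defs
open import Data.Nat as ℕ using (ℕ; zero; suc; _∸_; s≤s)
import Data.Nat.Properties as ℕP
open import Data.Fin as Fin using (Fin; toℕ; fromℕ; fromℕ<)
import Data.Fin.Properties as FinP
open import Data.Rational using (ℚ; 0ℚ; _+_; _-_; _*_; _⊔_; _≤_; _<_; -_)
import Data.Rational.Properties as ℚP
open import Data.Rational.Solver using (module +-*-Solver)
open import Data.List
  using (List; []; _∷_; map; foldr; upTo; applyUpTo; allFin; concatMap; cartesianProduct; filter)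
import Data.List.Properties as ListP
import Data.List.Extrema as Extrema
import Data.List.Relation.Unary.All as ListAll
import Data.List.Relation.Unary.All.Properties as ListAllP
import Data.List.Relation.Unary.Any as Any
open import Data.List.Relation.Unary.Any using (here; there)
open import Data.List.Membership.Propositional using (_∈_)
open import Data.List.Membership.Propositional.Properties
  using (∈-upTo⁺; ∈-upTo⁻; ∈-allFin; ∈-map⁺; ∈-concatMap⁺; ∈-cartesianProduct⁺; ∈-filter⁺)
open import Data.Vec as Vec using (Vec)
import Data.Vec.Properties as VecP
import Data.Vec.Relation.Unary.All as VecAll
import Data.Vec.Relation.Unary.All.Properties as VecAllP
open import Data.Product using (Σ; _×_; _,_; proj₁; proj₂)
open import Data.Sum using (_⊎_; inj₁; inj₂)
open import Data.Empty using (⊥-elim)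
open import Function using (case_of_)
open import Relation.Nullary using (Dec; yes; no; ¬_; contradiction)
open import Relation.Nullary.Decidable using (_×-dec_; _→-dec_)
open import Relation.Binary using (TotalOrder; DecTotalOrder; tri<; tri≈; tri>)
open import Level using (0ℓ)
open import Relation.Binary.PropositionalEquality

open +-*-Solver

ℚ-totalOrder : TotalOrder 0ℓ 0ℓ 0ℓ
ℚ-totalOrder = DecTotalOrder.totalOrder ℚP.≤-decTotalOrder

p≤q⇒0≤q-p : ∀ {p q} → p ≤ q → 0ℚ ≤ q - p
p≤q⇒0≤q-p {p} {q} p≤q = subst (_≤ q - p) (ℚP.+-inverseʳ p) (ℚP.+-monoˡ-≤ (- p) p≤q)

p≤q⇒p-q≤0 : ∀ {p q} → p ≤ q → p - q ≤ 0ℚ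
p≤q⇒p-q≤0 {p} {q} p≤q = subst (p - q ≤_) (ℚP.+-inverseʳ q) (ℚP.+-monoˡ-≤ (- q) p≤q)

p+[q-p]≡q : ∀ p q → p + (q - p) ≡ q
p+[q-p]≡q = solve 2 (λ p q → p :+ (q :- p) := q) refl

p+d≤q⇒r≤s+d⇒p-s≤q-r : ∀ {p q r s d} → p + d ≤ q → r ≤ s + d → p - s ≤ q - r
p+d≤q⇒r≤s+d⇒p-s≤q-r {p} {q} {r} {s} {d} p+d≤q r≤s+d =
  subst (_≤ q - r) (cancel p s d) (ℚP.+-mono-≤ p+d≤q (ℚP.neg-antimono-≤ r≤s+d))
  where
  cancel : ∀ p s d → (p + d) - (s + d) ≡ p - s
  cancel = solve 3 (λ p s d → (p :+ d) :- (s :+ d) := p :- s) refl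

module _ {A : Set} (f : A → ℚ) where

  maxL-upper : ∀ {xs a} → a ∈ xs → f a ≤ maxL (map f xs)
  maxL-upper {x ∷ xs} (here refl)  = ℚP.p≤p⊔q (f x) (maxL (map f xs))
  maxL-upper {x ∷ xs} (there a∈xs) = ℚP.≤-trans (maxL-upper a∈xs) (ℚP.p≤q⊔p (f x) _)

  maxL-attained : ∀ xs → maxL (map f xs) ≡ 0ℚ ⊎ Σ A λ a → a ∈ xs × maxL (map f xs) ≡ f a
  maxL-attained [] = inj₁ refl
  maxL-attained (x ∷ xs) with ℚP.⊔-sel (f x) (maxL (map f xs)) | maxL-attained xs
  ... | inj₁ eq | _                     = inj₂ (x , here refl , eq)
  ... | inj₂ eq | inj₁ eq₀              = inj₁ (trans eq eq₀)
  ... | inj₂ eq | inj₂ (a , a∈xs , eq′) = inj₂ (a , there a∈xs , trans eq eq′)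

maxL-nonneg : ∀ xs → 0ℚ ≤ maxL xs
maxL-nonneg []       = ℚP.≤-refl
maxL-nonneg (x ∷ xs) = ℚP.≤-trans (maxL-nonneg xs) (ℚP.p≤q⊔p x _)

maxL-≤-+ : ∀ {A : Set} (f g : A → ℚ) {d} → 0ℚ ≤ d → ∀ xs →
  (∀ a → a ∈ xs → f a ≤ g a + d) → maxL (map f xs) ≤ maxL (map g xs) + d
maxL-≤-+ f g {d} 0≤d [] _ = subst (0ℚ ≤_) (sym (ℚP.+-identityˡ d)) 0≤d
maxL-≤-+ f g {d} 0≤d (x ∷ xs) f≤g+d = ℚP.⊔-lub
  (ℚP.≤-trans (f≤g+d x (here refl)) (ℚP.+-monoˡ-≤ d (ℚP.p≤p⊔q (g x) _)))
  (ℚP.≤-trans (maxL-≤-+ f g 0≤d xs (λ a a∈xs → f≤g+d a (there a∈xs)))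
              (ℚP.+-monoˡ-≤ d (ℚP.p≤q⊔p (g x) _)))

sumFrom : (ℕ → ℚ) → ℕ → ℕ → ℚ
sumFrom f a zero    = 0ℚ
sumFrom f a (suc m) = f a + sumFrom f (suc a) m

sumW≡sumFrom : ∀ f a b → sumW f a b ≡ sumFrom f a (suc b ∸ a)
sumW≡sumFrom f a b = go (suc b ∸ a) (λ j → j) a (λ j → refl)
  where
  go : ∀ m (h : ℕ → ℕ) a′ → (∀ j → a ℕ.+ h j ≡ a′ ℕ.+ j) →
       foldr _+_ 0ℚ (map (λ j → f (a ℕ.+ j)) (applyUpTo h m)) ≡ sumFrom f a′ m
  go zero    h a′ eq = refl
  go (suc m) h a′ eq = cong₂ _+_ (cong f (trans (eq 0) (ℕP.+-identityʳ a′)))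
    (go m (λ j → h (suc j)) (suc a′) (λ j → trans (eq (suc j)) (ℕP.+-suc a′ j)))

sumFrom-++ : ∀ f a m m′ → sumFrom f a (m ℕ.+ m′) ≡ sumFrom f a m + sumFrom f (a ℕ.+ m) m′
sumFrom-++ f a zero m′ = begin
  sumFrom f a m′               ≡⟨ cong (λ a′ → sumFrom f a′ m′) (sym (ℕP.+-identityʳ a)) ⟩
  sumFrom f (a ℕ.+ 0) m′       ≡⟨ sym (ℚP.+-identityˡ _) ⟩
  0ℚ + sumFrom f (a ℕ.+ 0) m′  ∎
  where open ≡-Reasoning
sumFrom-++ f a (suc m) m′ = begin
  f a + sumFrom f (suc a) (m ℕ.+ m′)
    ≡⟨ cong (f a +_) (sumFrom-++ f (suc a) m m′) ⟩
  f a + (sumFrom f (suc a) m + sumFrom f (suc a ℕ.+ m) m′)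
    ≡⟨ sym (ℚP.+-assoc (f a) _ _) ⟩
  (f a + sumFrom f (suc a) m) + sumFrom f (suc a ℕ.+ m) m′
    ≡⟨ cong (λ a′ → (f a + sumFrom f (suc a) m) + sumFrom f a′ m′) (sym (ℕP.+-suc a m)) ⟩
  (f a + sumFrom f (suc a) m) + sumFrom f (a ℕ.+ suc m) m′  ∎
  where open ≡-Reasoning

interval-widen : ∀ {a m j} → suc a ℕ.≤ j → j ℕ.< suc a ℕ.+ m → a ℕ.≤ j × j ℕ.< a ℕ.+ suc m
interval-widen {a} {m} {j} a<j j<1+a+m = ℕP.<⇒≤ a<j , subst (j ℕ.<_) (sym (ℕP.+-suc a m)) j<1+a+m

sumFrom-mono : ∀ f g a m → (∀ j → a ℕ.≤ j → j ℕ.< a ℕ.+ m → f j ≤ g j) →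
  sumFrom f a m ≤ sumFrom g a m
sumFrom-mono f g a zero    f≤g = ℚP.≤-refl
sumFrom-mono f g a (suc m) f≤g = ℚP.+-mono-≤ (f≤g a ℕP.≤-refl (ℕP.m<m+n a ℕ.z<s))
  (sumFrom-mono f g (suc a) m λ j a<j j<1+a+m →
    let (a≤j , j<a+1+m) = interval-widen {a} {m} a<j j<1+a+m in f≤g j a≤j j<a+1+m)

sumFrom-vanishes : ∀ f a m → (∀ j → a ℕ.≤ j → j ℕ.< a ℕ.+ m → f j ≡ 0ℚ) →
  sumFrom f a m ≡ 0ℚ
sumFrom-vanishes f a zero    f≡0 = refl
sumFrom-vanishes f a (suc m) f≡0 = trans
  (cong₂ _+_ (f≡0 a ℕP.≤-refl (ℕP.m<m+n a ℕ.z<s))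
             (sumFrom-vanishes f (suc a) m λ j a<j j<1+a+m →
               let (a≤j , j<a+1+m) = interval-widen {a} {m} a<j j<1+a+m in f≡0 j a≤j j<a+1+m))
  (ℚP.+-identityˡ 0ℚ)

sumFrom-+ : ∀ f g a m → sumFrom f a m + sumFrom g a m ≡ sumFrom (λ j → f j + g j) a m
sumFrom-+ f g a zero    = ℚP.+-identityʳ 0ℚ
sumFrom-+ f g a (suc m) =
  trans (interchange (f a) (sumFrom f (suc a) m) (g a) (sumFrom g (suc a) m))
        (cong ((f a + g a) +_) (sumFrom-+ f g (suc a) m))
  where
  interchange : ∀ x y z w → (x + y) + (z + w) ≡ (x + z) + (y + w)
  interchange = solve 4 (λ x y z w → (x :+ y) :+ (z :+ w) := (x :+ z) :+ (y :+ w)) refl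

sumFrom-nonneg : ∀ f → (∀ j → 0ℚ ≤ f j) → ∀ a m → 0ℚ ≤ sumFrom f a m
sumFrom-nonneg f 0≤f a m =
  subst (_≤ sumFrom f a m) (sumFrom-vanishes (λ _ → 0ℚ) a m (λ _ _ _ → refl))
        (sumFrom-mono (λ _ → 0ℚ) f a m (λ j _ _ → 0≤f j))

sumFrom-split₃ : ∀ f a m {N} → a ℕ.+ m ℕ.≤ N →
  sumFrom f 0 N ≡ sumFrom f 0 a + (sumFrom f a m + sumFrom f (a ℕ.+ m) (N ∸ (a ℕ.+ m)))
sumFrom-split₃ f a m {N} a+m≤N = begin
  sumFrom f 0 N                                            ≡⟨ cong (sumFrom f 0) N≡a+[m+r] ⟩
  sumFrom f 0 (a ℕ.+ (m ℕ.+ r))                            ≡⟨ sumFrom-++ f 0 a (m ℕ.+ r) ⟩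
  sumFrom f 0 a + sumFrom f a (m ℕ.+ r)                    ≡⟨ cong (sumFrom f 0 a +_) (sumFrom-++ f a m r) ⟩
  sumFrom f 0 a + (sumFrom f a m + sumFrom f (a ℕ.+ m) r)  ∎
  where
  open ≡-Reasoning
  r : ℕ
  r = N ∸ (a ℕ.+ m)
  N≡a+[m+r] : N ≡ a ℕ.+ (m ℕ.+ r)
  N≡a+[m+r] = trans (sym (ℕP.m+[n∸m]≡n a+m≤N)) (ℕP.+-assoc a m r)

sumFrom-≤-whole : ∀ f → (∀ j → 0ℚ ≤ f j) → ∀ a m {N} → a ℕ.+ m ℕ.≤ N →
  sumFrom f a m ≤ sumFrom f 0 N
sumFrom-≤-whole f 0≤f a m {N} a+m≤N = begin
  sumFrom f a m                  ≡⟨ sym (trans (ℚP.+-identityˡ _) (ℚP.+-identityʳ _)) ⟩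
  0ℚ + (sumFrom f a m + 0ℚ)      ≤⟨ ℚP.+-mono-≤ (sumFrom-nonneg f 0≤f 0 a)
                                      (ℚP.+-monoʳ-≤ (sumFrom f a m) (sumFrom-nonneg f 0≤f (a ℕ.+ m) r)) ⟩
  sumFrom f 0 a + (sumFrom f a m + sumFrom f (a ℕ.+ m) r)
                                 ≡⟨ sym (sumFrom-split₃ f a m a+m≤N) ⟩
  sumFrom f 0 N                  ∎
  where
  open ℚP.≤-Reasoning
  r : ℕ
  r = N ∸ (a ℕ.+ m)

sumFrom-concentrated : ∀ f a m {N} → a ℕ.+ m ℕ.≤ N →
  (∀ j → j ℕ.< N → (j ℕ.< a ⊎ a ℕ.+ m ℕ.≤ j) → f j ≡ 0ℚ) → sumFrom f 0 N ≡ sumFrom f a m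
sumFrom-concentrated f a m {N} a+m≤N f≡0 = begin
  sumFrom f 0 N                  ≡⟨ sumFrom-split₃ f a m a+m≤N ⟩
  sumFrom f 0 a + (sumFrom f a m + sumFrom f (a ℕ.+ m) (N ∸ (a ℕ.+ m)))
                                 ≡⟨ cong₂ (λ u v → u + (sumFrom f a m + v)) before after ⟩
  0ℚ + (sumFrom f a m + 0ℚ)      ≡⟨ trans (ℚP.+-identityˡ _) (ℚP.+-identityʳ _) ⟩
  sumFrom f a m                  ∎
  where
  open ≡-Reasoning
  before : sumFrom f 0 a ≡ 0ℚ
  before = sumFrom-vanishes f 0 a λ j _ j<a →
    f≡0 j (ℕP.<-≤-trans j<a (ℕP.≤-trans (ℕP.m≤m+n a m) a+m≤N)) (inj₁ j<a)
  after : sumFrom f (a ℕ.+ m) (N ∸ (a ℕ.+ m)) ≡ 0ℚ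
  after = sumFrom-vanishes f (a ℕ.+ m) _ λ j a+m≤j j<N →
    f≡0 j (subst (j ℕ.<_) (ℕP.m+[n∸m]≡n a+m≤N) j<N) (inj₂ a+m≤j)

sumW-≤-whole : ∀ f → (∀ j → 0ℚ ≤ f j) → ∀ a {b n} → b ℕ.≤ n →
  sumW f a b ≤ sumFrom f 0 (suc n)
sumW-≤-whole f 0≤f a {b} {n} b≤n rewrite sumW≡sumFrom f a b with a ℕ.≤? suc b
... | yes a≤1+b = sumFrom-≤-whole f 0≤f a (suc b ∸ a)
                    (subst (ℕ._≤ suc n) (sym (ℕP.m+[n∸m]≡n a≤1+b)) (s≤s b≤n))
... | no a≰1+b rewrite ℕP.m≤n⇒m∸n≡0 (ℕP.<⇒≤ (ℕP.≰⇒> a≰1+b)) = sumFrom-nonneg f 0≤f 0 (suc n)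

left≤right : ∀ {n k} (Π : KPartition n k) p → left Π p ℕ.≤ right Π p
left≤right Π p = ℕP.≤-trans (sink-l Π p) (sink-r Π p)

right<left : ∀ {n k} (Π : KPartition n k) {p q} → toℕ p ℕ.< toℕ q → right Π p ℕ.< left Π q
right<left {k = k} Π {p} {q} p<q = go (toℕ q ∸ suc (toℕ p)) q (sym (ℕP.m∸n+n≡m p<q))
  where
  go : ∀ m q → toℕ q ≡ m ℕ.+ suc (toℕ p) → right Π p ℕ.< left Π q
  go zero    q eq = ℕP.≤-reflexive (sym (consec Π p q eq))
  go (suc m) q eq = ℕP.<-≤-trans (go m q′ toℕq′) (ℕP.≤-trans (left≤right Π q′) (ℕP.<⇒≤ q′<q))
    where
    q′ : Fin k
    q′ = fromℕ< (ℕP.<-trans (ℕP.n<1+n (m ℕ.+ suc (toℕ p))) (subst (ℕ._< _) eq (FinP.toℕ<n q)))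
    toℕq′ : toℕ q′ ≡ m ℕ.+ suc (toℕ p)
    toℕq′ = FinP.toℕ-fromℕ< _
    q′<q : right Π q′ ℕ.< left Π q
    q′<q = ℕP.≤-reflexive (sym (consec Π q′ q (trans eq (cong suc (sym toℕq′)))))

right≤n : ∀ {n k} (Π : KPartition n k) p → right Π p ℕ.≤ n
right≤n {n} {suc k} Π p with ℕP.m≤n⇒m<n∨m≡n (FinP.toℕ≤pred[n] p)
... | inj₂ p-is-last = ℕP.≤-reflexive (last Π p (cong suc p-is-last))
... | inj₁ p<last    =
  ℕP.<⇒≤ (ℕP.<-≤-trans (right<left Π p<L) (ℕP.≤-trans (left≤right Π L) right-L≤n))
  where
  L : Fin (suc k)
  L = fromℕ k
  toℕL : toℕ L ≡ k
  toℕL = FinP.toℕ-fromℕ k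
  p<L : toℕ p ℕ.< toℕ L
  p<L = subst (toℕ p ℕ.<_) (sym toℕL) p<last
  right-L≤n : right Π L ℕ.≤ n
  right-L≤n = ℕP.≤-reflexive (last Π L (cong suc toℕL))

parts-disjoint : ∀ {n k} (Π : KPartition n k) {p q j} →
  left Π p ℕ.≤ j → j ℕ.≤ right Π p → left Π q ℕ.≤ j → j ℕ.≤ right Π q → p ≡ q
parts-disjoint Π {p} {q} lp≤j j≤rp lq≤j j≤rq with ℕP.<-cmp (toℕ p) (toℕ q)
... | tri< p<q _ _ = ⊥-elim (ℕP.<⇒≱ (right<left Π p<q) (ℕP.≤-trans lq≤j j≤rp))
... | tri≈ _ p≡q _ = FinP.toℕ-injective p≡q
... | tri> _ _ q<p = ⊥-elim (ℕP.<⇒≱ (right<left Π q<p) (ℕP.≤-trans lp≤j j≤rq))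

module _ {n : ℕ} (P : PathInstance n) where

  termL : (ℕ → ℚ) → ℕ → ℕ → ℕ → ℚ
  termL s l t j = ((x P t - x P (l ℕ.+ j)) * τ P) + sumW s l (l ℕ.+ j)

  termR : (ℕ → ℚ) → ℕ → ℕ → ℕ → ℚ
  termR s t r j = ((x P (suc t ℕ.+ j) - x P t) * τ P) + sumW s (suc t ℕ.+ j) r

  ΘLPart ΘRPart : ∀ {k} → KPartition n k → (ℕ → ℚ) → Fin k → ℚ
  ΘLPart Π s p = ΘL (x P) (τ P) s (left Π p) (right Π p) (sink Π p)
  ΘRPart Π s p = ΘR (x P) (τ P) s (left Π p) (right Π p) (sink Π p)

  module _ {k} (Π : KPartition n k) (s : ℕ → ℚ) (p : Fin k) where

    termL≤Θk : ∀ {j} → j ∈ upTo (sink Π p ∸ left Π p) → termL s (left Π p) (sink Π p) j ≤ Θk P Π s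
    termL≤Θk j∈ = ℚP.≤-trans (maxL-upper (termL s (left Π p) (sink Π p)) j∈)
      (ℚP.≤-trans (ℚP.p≤p⊔q (ΘLPart Π s p) (ΘRPart Π s p)) (maxL-upper (ΘPart P Π s) (∈-allFin p)))

    termR≤Θk : ∀ {j} → j ∈ upTo (right Π p ∸ sink Π p) → termR s (sink Π p) (right Π p) j ≤ Θk P Π s
    termR≤Θk j∈ = ℚP.≤-trans (maxL-upper (termR s (sink Π p) (right Π p)) j∈)
      (ℚP.≤-trans (ℚP.p≤q⊔p (ΘLPart Π s p) (ΘRPart Π s p)) (maxL-upper (ΘPart P Π s) (∈-allFin p)))

  Θk-≤-+ : ∀ {k} (Π : KPartition n k) c s {d} → 0ℚ ≤ d →
    (∀ a b → b ℕ.≤ n → sumW c a b ≤ sumW s a b + d) → Θk P Π c ≤ Θk P Π s + d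
  Θk-≤-+ {k} Π c s {d} 0≤d c≤s+d =
    maxL-≤-+ (ΘPart P Π c) (ΘPart P Π s) 0≤d (allFin k) (λ p _ → part p)
    where
    shift : ∀ X {u v} → u ≤ v + d → X + u ≤ (X + v) + d
    shift X {u} {v} u≤v+d =
      ℚP.≤-trans (ℚP.+-monoʳ-≤ X u≤v+d) (ℚP.≤-reflexive (sym (ℚP.+-assoc X v d)))

    part : ∀ p → ΘPart P Π c p ≤ ΘPart P Π s p + d
    part p = ℚP.⊔-lub (ℚP.≤-trans ΘL≤ (ℚP.+-monoˡ-≤ d (ℚP.p≤p⊔q (ΘLPart Π s p) (ΘRPart Π s p))))
                      (ℚP.≤-trans ΘR≤ (ℚP.+-monoˡ-≤ d (ℚP.p≤q⊔p (ΘLPart Π s p) (ΘRPart Π s p))))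
      where
      l r t : ℕ
      l = left Π p
      r = right Π p
      t = sink Π p
      l+j≤n : ∀ {j} → j ∈ upTo (t ∸ l) → l ℕ.+ j ℕ.≤ n
      l+j≤n j∈ = ℕP.<⇒≤ (ℕP.<-≤-trans
        (subst (_ ℕ.<_) (ℕP.m+[n∸m]≡n (sink-l Π p)) (ℕP.+-monoʳ-< l (∈-upTo⁻ j∈)))
        (ℕP.≤-trans (sink-r Π p) (right≤n Π p)))
      ΘL≤ : ΘLPart Π c p ≤ ΘLPart Π s p + d
      ΘL≤ = maxL-≤-+ (termL c l t) (termL s l t) 0≤d (upTo (t ∸ l)) λ j j∈ →
        shift ((x P t - x P (l ℕ.+ j)) * τ P) (c≤s+d l (l ℕ.+ j) (l+j≤n j∈))
      ΘR≤ : ΘRPart Π c p ≤ ΘRPart Π s p + d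
      ΘR≤ = maxL-≤-+ (termR c t r) (termR s t r) 0≤d (upTo (r ∸ t)) λ j _ →
        shift ((x P (suc t ℕ.+ j) - x P t) * τ P) (c≤s+d (suc t ℕ.+ j) r (right≤n Π p))

vecsOver : ∀ {A : Set} → List A → (m : ℕ) → List (Vec A m)
vecsOver xs zero    = Vec.[] ∷ []
vecsOver xs (suc m) = concatMap (λ y → map (y Vec.∷_) (vecsOver xs m)) xs

∈-vecsOver : ∀ {A : Set} {xs : List A} {m} {v : Vec A m} → VecAll.All (_∈ xs) v → v ∈ vecsOver xs m
∈-vecsOver VecAll.[] = here refl
∈-vecsOver {xs = xs} {v = y Vec.∷ v} (y∈xs VecAll.∷ v⊆xs) =
  ∈-concatMap⁺ (λ z → map (z Vec.∷_) (vecsOver xs _))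
               (Any.map (λ { refl → ∈-map⁺ (y Vec.∷_) (∈-vecsOver v⊆xs) }) y∈xs)

-- A partition is encoded by the vector of its triples (left, right, sink); there are
-- finitely many such vectors, so Θ^k_opt is a minimum over a finite list. The given
-- partition Π₀ supplies k-pos and a default for the minimum.
module Optimum {n k : ℕ} (P : PathInstance n) (Π₀ : KPartition n k) where

  Triple : Set
  Triple = ℕ × ℕ × ℕ

  module _ (v : Vec Triple k) where

    lefts rights sinks : Fin k → ℕ
    lefts  i = proj₁ (Vec.lookup v i)
    rights i = proj₁ (proj₂ (Vec.lookup v i))
    sinks  i = proj₂ (proj₂ (Vec.lookup v i))

    IsPartitionVec : Set
    IsPartitionVec =
      (∀ i → toℕ i ≡ 0 → lefts i ≡ 0) × (∀ i → suc (toℕ i) ≡ k → rights i ≡ n) ×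
      (∀ i j → toℕ j ≡ suc (toℕ i) → lefts j ≡ suc (rights i)) ×
      (∀ i → lefts i ℕ.≤ sinks i) × (∀ i → sinks i ℕ.≤ rights i)

    isPartitionVec? : Dec IsPartitionVec
    isPartitionVec? =
      FinP.all? (λ i → (toℕ i ℕ.≟ 0) →-dec (lefts i ℕ.≟ 0)) ×-dec
      FinP.all? (λ i → (suc (toℕ i) ℕ.≟ k) →-dec (rights i ℕ.≟ n)) ×-dec
      FinP.all? (λ i → FinP.all? λ j →
        (toℕ j ℕ.≟ suc (toℕ i)) →-dec (lefts j ℕ.≟ suc (rights i))) ×-dec
      FinP.all? (λ i → lefts i ℕ.≤? sinks i) ×-dec
      FinP.all? (λ i → sinks i ℕ.≤? rights i)

    fromVec : IsPartitionVec → KPartition n k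
    fromVec (first′ , last′ , consec′ , sink-l′ , sink-r′) = record
      { left = lefts ; right = rights ; sink = sinks ; k-pos = k-pos Π₀
      ; first = first′ ; last = last′ ; consec = consec′ ; sink-l = sink-l′ ; sink-r = sink-r′ }

    ΘVec : (ℕ → ℚ) → ℚ
    ΘVec s = maxL (map (λ i → Θ1 (x P) (τ P) s (lefts i) (rights i) (sinks i)) (allFin k))

  toVec : KPartition n k → Vec Triple k
  toVec Π = Vec.tabulate (λ i → left Π i , right Π i , sink Π i)

  module _ (Π : KPartition n k) where

    lookup-toVec : ∀ i → Vec.lookup (toVec Π) i ≡ (left Π i , right Π i , sink Π i)
    lookup-toVec = VecP.lookup∘tabulate _

    lefts-toVec : ∀ i → lefts (toVec Π) i ≡ left Π i
    lefts-toVec i = cong proj₁ (lookup-toVec i)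

    rights-toVec : ∀ i → rights (toVec Π) i ≡ right Π i
    rights-toVec i = cong (λ t → proj₁ (proj₂ t)) (lookup-toVec i)

    sinks-toVec : ∀ i → sinks (toVec Π) i ≡ sink Π i
    sinks-toVec i = cong (λ t → proj₂ (proj₂ t)) (lookup-toVec i)

    toVec-isPartitionVec : IsPartitionVec (toVec Π)
    toVec-isPartitionVec =
      (λ i eq → trans (lefts-toVec i) (first Π i eq)) ,
      (λ i eq → trans (rights-toVec i) (last Π i eq)) ,
      (λ i j eq → trans (lefts-toVec j) (trans (consec Π i j eq) (cong suc (sym (rights-toVec i))))) ,
      (λ i → subst₂ ℕ._≤_ (sym (lefts-toVec i)) (sym (sinks-toVec i)) (sink-l Π i)) ,
      (λ i → subst₂ ℕ._≤_ (sym (sinks-toVec i)) (sym (rights-toVec i)) (sink-r Π i))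

    ΘVec-toVec : ∀ s → ΘVec (toVec Π) s ≡ Θk P Π s
    ΘVec-toVec s = cong maxL (ListP.map-cong (λ i →
      cong₂ (λ l rt → Θ1 (x P) (τ P) s l (proj₁ rt) (proj₂ rt)) (lefts-toVec i)
            (cong₂ _,_ (rights-toVec i) (sinks-toVec i))) (allFin k))

  triples : List Triple
  triples = cartesianProduct (upTo (suc n)) (cartesianProduct (upTo (suc n)) (upTo (suc n)))

  toVec-∈ : ∀ Π → toVec Π ∈ vecsOver triples k
  toVec-∈ Π = ∈-vecsOver (VecAllP.tabulate⁺ λ i →
    ∈-cartesianProduct⁺ (∈-upTo⁺ (s≤s (ℕP.≤-trans (left≤right Π i) (right≤n Π i))))
      (∈-cartesianProduct⁺ (∈-upTo⁺ (s≤s (right≤n Π i)))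
                           (∈-upTo⁺ (s≤s (ℕP.≤-trans (sink-r Π i) (right≤n Π i))))))

  partitionVecs : List (Vec Triple k)
  partitionVecs = filter isPartitionVec? (vecsOver triples k)

  optimum : ∀ s → Σ ℚ (IsOpt P k s)
  optimum s = ΘVec v* s , (fromVec v* v*-isPartitionVec , refl) , v*-minimal
    where
    open Extrema ℚ-totalOrder using (argmin; argmin-all; f[argmin]≤f[xs])
    v* : Vec Triple k
    v* = argmin (λ v → ΘVec v s) (toVec Π₀) partitionVecs
    v*-isPartitionVec : IsPartitionVec v*
    v*-isPartitionVec = argmin-all (λ v → ΘVec v s) {toVec Π₀} {partitionVecs} {P = IsPartitionVec}
      (toVec-isPartitionVec Π₀) (ListAllP.all-filter isPartitionVec? (vecsOver triples k))
    v*-minimal : ∀ Π → ΘVec v* s ≤ Θk P Π s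
    v*-minimal Π = subst (ΘVec v* s ≤_) (ΘVec-toVec Π s)
      (ListAll.lookup (f[argmin]≤f[xs] {f = λ v → ΘVec v s} (toVec Π₀) partitionVecs)
                      (∈-filter⁺ isPartitionVec? (toVec-∈ Π) (toVec-isPartitionVec Π)))

module _ {n : ℕ} (P : PathInstance n) where

  raised : ℕ → ℕ → ℕ → ℚ
  raised a b j with a ℕ.≤? j | j ℕ.≤? b
  ... | yes _ | yes _ = w⁺ P j
  ... | _     | _     = w⁻ P j

  raised-inside : ∀ {a b j} → a ℕ.≤ j → j ℕ.≤ b → raised a b j ≡ w⁺ P j
  raised-inside {a} {b} {j} a≤j j≤b with a ℕ.≤? j | j ℕ.≤? b
  ... | yes _  | yes _  = refl
  ... | no a≰j | _      = contradiction a≤j a≰j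
  ... | yes _  | no j≰b = contradiction j≤b j≰b

  raised-outside : ∀ {a b j} → ¬ (a ℕ.≤ j × j ℕ.≤ b) → raised a b j ≡ w⁻ P j
  raised-outside {a} {b} {j} ∉ab with a ℕ.≤? j | j ℕ.≤? b
  ... | yes a≤j | yes j≤b = contradiction (a≤j , j≤b) ∉ab
  ... | no _    | _       = refl
  ... | yes _   | no _    = refl

  raised-isScenario : ∀ a b → IsScenario P (raised a b)
  raised-isScenario a b j j≤n with a ℕ.≤? j | j ℕ.≤? b
  ... | yes _ | yes _ = w⁻≤w⁺ P j j≤n , ℚP.≤-refl
  ... | no _  | _     = ℚP.≤-refl , w⁻≤w⁺ P j j≤n
  ... | yes _ | no _  = ℚP.≤-refl , w⁻≤w⁺ P j j≤n

  w⁻-on⇒LeftDominant : ∀ {s l r} → l ℕ.≤ r → (∀ j → l ℕ.≤ j → j ℕ.≤ r → s j ≡ w⁻ P j) →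
    LeftDominant P s l r
  w⁻-on⇒LeftDominant {l = l} l≤r s≡w⁻ =
    l , ℕP.≤-refl , l≤r , (λ j l≤j j<l → contradiction l≤j (ℕP.<⇒≱ j<l)) , s≡w⁻

  module Raise (s : ℕ → ℚ) (s-scen : IsScenario P s) {a b : ℕ} (a≤b : a ℕ.≤ b) (b≤n : b ℕ.≤ n) where

    gap : ℕ → ℚ
    gap j = (raised a b j - s j) ⊔ 0ℚ

    gain : ℚ
    gain = sumFrom gap 0 (suc n)

    gap-nonneg : ∀ j → 0ℚ ≤ gap j
    gap-nonneg j = ℚP.p≤q⊔p (raised a b j - s j) 0ℚ

    gain-nonneg : 0ℚ ≤ gain
    gain-nonneg = sumFrom-nonneg gap gap-nonneg 0 (suc n)

    raised≤s+gap : ∀ j → raised a b j ≤ s j + gap j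
    raised≤s+gap j = subst (_≤ s j + gap j) (p+[q-p]≡q (s j) (raised a b j))
                           (ℚP.+-monoʳ-≤ (s j) (ℚP.p≤p⊔q (raised a b j - s j) 0ℚ))

    s+gap≡raised : ∀ {j} → a ℕ.≤ j → j ℕ.≤ b → s j + gap j ≡ raised a b j
    s+gap≡raised {j} a≤j j≤b = trans (cong (s j +_) (ℚP.p≥q⇒p⊔q≡p (p≤q⇒0≤q-p s≤raised)))
                                     (p+[q-p]≡q (s j) (raised a b j))
      where
      s≤raised : s j ≤ raised a b j
      s≤raised = subst (s j ≤_) (sym (raised-inside a≤j j≤b)) (proj₂ (s-scen j (ℕP.≤-trans j≤b b≤n)))

    gap-outside : ∀ {j} → j ℕ.≤ n → ¬ (a ℕ.≤ j × j ℕ.≤ b) → gap j ≡ 0ℚ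
    gap-outside {j} j≤n ∉ab = ℚP.p≤q⇒p⊔q≡q
      (p≤q⇒p-q≤0 (subst (_≤ s j) (sym (raised-outside ∉ab)) (proj₁ (s-scen j j≤n))))

    sumW-raised≤ : ∀ a′ {b′} → b′ ℕ.≤ n → sumW (raised a b) a′ b′ ≤ sumW s a′ b′ + gain
    sumW-raised≤ a′ {b′} b′≤n = begin
      sumW (raised a b) a′ b′
        ≡⟨ sumW≡sumFrom (raised a b) a′ b′ ⟩
      sumFrom (raised a b) a′ m
        ≤⟨ sumFrom-mono (raised a b) s+gap a′ m (λ j _ _ → raised≤s+gap j) ⟩
      sumFrom s+gap a′ m
        ≡⟨ sym (sumFrom-+ s gap a′ m) ⟩
      sumFrom s a′ m + sumFrom gap a′ m
        ≡⟨ cong₂ _+_ (sym (sumW≡sumFrom s a′ b′)) (sym (sumW≡sumFrom gap a′ b′)) ⟩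
      sumW s a′ b′ + sumW gap a′ b′
        ≤⟨ ℚP.+-monoʳ-≤ (sumW s a′ b′) (sumW-≤-whole gap gap-nonneg a′ b′≤n) ⟩
      sumW s a′ b′ + gain
        ∎
      where
      open ℚP.≤-Reasoning
      m : ℕ
      m = suc b′ ∸ a′
      s+gap : ℕ → ℚ
      s+gap j = s j + gap j

    sumW-raised≥ : sumW s a b + gain ≤ sumW (raised a b) a b
    sumW-raised≥ = begin
      sumW s a b + gain                 ≡⟨ cong₂ _+_ (sumW≡sumFrom s a b) gain≡block ⟩
      sumFrom s a m + sumFrom gap a m   ≡⟨ sumFrom-+ s gap a m ⟩
      sumFrom s+gap a m                 ≤⟨ sumFrom-mono s+gap (raised a b) a m inside ⟩
      sumFrom (raised a b) a m          ≡⟨ sym (sumW≡sumFrom (raised a b) a b) ⟩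
      sumW (raised a b) a b             ∎
      where
      open ℚP.≤-Reasoning
      m : ℕ
      m = suc b ∸ a
      s+gap : ℕ → ℚ
      s+gap j = s j + gap j
      a+m≡1+b : a ℕ.+ m ≡ suc b
      a+m≡1+b = ℕP.m+[n∸m]≡n (ℕP.≤-trans a≤b (ℕP.n≤1+n b))
      gain≡block : gain ≡ sumFrom gap a m
      gain≡block = sumFrom-concentrated gap a m (subst (ℕ._≤ suc n) (sym a+m≡1+b) (s≤s b≤n))
        λ j j<1+n out → gap-outside (ℕP.≤-pred j<1+n) λ (a≤j , j≤b) → case out of λ
          { (inj₁ j<a)   → ℕP.<⇒≱ j<a a≤j
          ; (inj₂ a+m≤j) → ℕP.<⇒≱ (s≤s j≤b) (subst (ℕ._≤ j) a+m≡1+b a+m≤j) }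
      inside : ∀ j → a ℕ.≤ j → j ℕ.< a ℕ.+ m → s+gap j ≤ raised a b j
      inside j a≤j j<a+m =
        ℚP.≤-reflexive (s+gap≡raised a≤j (ℕP.≤-pred (subst (j ℕ.<_) a+m≡1+b j<a+m)))

module Regret {n k : ℕ} (P : PathInstance n) (Π : KPartition n k) where

  open Optimum P Π using (optimum)

  opt : (ℕ → ℚ) → ℚ
  opt s = proj₁ (optimum s)

  opt-attained : ∀ s → Σ (KPartition n k) λ Π′ → Θk P Π′ s ≡ opt s
  opt-attained s = proj₁ (proj₂ (optimum s))

  opt-minimal : ∀ s Π′ → opt s ≤ Θk P Π′ s
  opt-minimal s = proj₂ (proj₂ (optimum s))

  IsOpt⇒≡opt : ∀ {s v} → IsOpt P k s v → v ≡ opt s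
  IsOpt⇒≡opt {s} {v} ((Π′ , Θk≡v) , v-minimal) = ℚP.≤-antisym
    (subst (v ≤_) (proj₂ (opt-attained s)) (v-minimal (proj₁ (opt-attained s))))
    (subst (opt s ≤_) Θk≡v (opt-minimal s Π′))

  -- Opaque so that the type checker never tries to evaluate the regret of a
  -- concrete scenario, which is hopelessly slow.
  opaque
    regret : (ℕ → ℚ) → ℚ
    regret s = Θk P Π s - opt s

    IsRegret⇒≡regret : ∀ {s r} → IsRegret P Π s r → r ≡ regret s
    IsRegret⇒≡regret {s} {r} (v , v-opt , r≡) = trans r≡ (cong (λ o → Θk P Π s - o) v≡opt)
      where
      v≡opt : v ≡ opt s
      v≡opt = IsOpt⇒≡opt {s} {v} v-opt

    regret-isRegret : ∀ s → IsRegret P Π s (regret s)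
    regret-isRegret s = opt s , proj₂ (optimum s) , refl

    regret-nonneg : ∀ s → 0ℚ ≤ regret s
    regret-nonneg s = p≤q⇒0≤q-p {opt s} {Θk P Π s} (opt-minimal s Π)

    Θk≡0⇒regret≤ : ∀ {s} → Θk P Π s ≡ 0ℚ → ∀ s′ → regret s ≤ regret s′
    Θk≡0⇒regret≤ {s} Θk≡0 s′ = ℚP.≤-trans regret≤0 (regret-nonneg s′)
      where
      Π′ : KPartition n k
      Π′ = proj₁ (opt-attained s)
      opt-nonneg : 0ℚ ≤ opt s
      opt-nonneg = subst (0ℚ ≤_) (proj₂ (opt-attained s)) (maxL-nonneg (map (ΘPart P Π′ s) (allFin k)))
      regret≤0 : regret s ≤ 0ℚ
      regret≤0 = subst (λ θ → θ - opt s ≤ 0ℚ) (sym Θk≡0) (p≤q⇒p-q≤0 {0ℚ} {opt s} opt-nonneg)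

    regret≤-by-shift : ∀ {s c} d → Θk P Π s + d ≤ Θk P Π c → opt c ≤ opt s + d → regret s ≤ regret c
    regret≤-by-shift {s} {c} d = p+d≤q⇒r≤s+d⇒p-s≤q-r {Θk P Π s} {Θk P Π c} {opt c} {opt s} {d}

  regret≤regret-raised : ∀ s → IsScenario P s → ∀ {a b} (a≤b : a ℕ.≤ b) (b≤n : b ℕ.≤ n) X →
    Θk P Π s ≡ X + sumW s a b → X + sumW (raised P a b) a b ≤ Θk P Π (raised P a b) →
    regret s ≤ regret (raised P a b)
  regret≤regret-raised s s-scen {a} {b} a≤b b≤n X Θk≡term term≤Θk =
    regret≤-by-shift {s} {c} gain Θk+gain≤ opt≤opt+gain
    where
    open Raise P s s-scen a≤b b≤n
    c : ℕ → ℚ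
    c = raised P a b
    Θk+gain≤ : Θk P Π s + gain ≤ Θk P Π c
    Θk+gain≤ = begin
      Θk P Π s + gain             ≡⟨ cong (_+ gain) Θk≡term ⟩
      (X + sumW s a b) + gain     ≡⟨ ℚP.+-assoc X (sumW s a b) gain ⟩
      X + (sumW s a b + gain)     ≤⟨ ℚP.+-monoʳ-≤ X sumW-raised≥ ⟩
      X + sumW c a b              ≤⟨ term≤Θk ⟩
      Θk P Π c                    ∎
      where open ℚP.≤-Reasoning
    Π′ : KPartition n k
    Π′ = proj₁ (opt-attained s)
    Θk′≤ : Θk P Π′ c ≤ opt s + gain
    Θk′≤ = subst (λ θ → Θk P Π′ c ≤ θ + gain) (proj₂ (opt-attained s))
                 (Θk-≤-+ P Π′ c s {gain} gain-nonneg (λ a′ _ b′≤n → sumW-raised≤ a′ b′≤n))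
    opt≤opt+gain : opt c ≤ opt s + gain
    opt≤opt+gain = ℚP.≤-trans {opt c} {Θk P Π′ c} {opt s + gain} (opt-minimal c Π′) Θk′≤

  -- The ranges of weights summed by the terms of Θ^1(P_p, y_p, ·); `none` is an
  -- empty range, raising on which gives the scenario w⁻.
  data Block : ℕ → ℕ → Set where
    none   : Block (suc n) n
    prefix : ∀ p {b} → left Π p ℕ.≤ b → b ℕ.< sink Π p → Block (left Π p) b
    suffix : ∀ p {a} → sink Π p ℕ.< a → a ℕ.≤ right Π p → Block a (right Π p)

  Block-bounds : ∀ {a b} → Block a b → a ℕ.≤ suc n × b ℕ.≤ n
  Block-bounds none = ℕP.≤-refl , ℕP.≤-refl
  Block-bounds (prefix p {b} l≤b b<t) = ℕP.≤-trans l≤b (ℕP.m≤n⇒m≤1+n b≤n) , b≤n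
    where
    b≤n : b ℕ.≤ n
    b≤n = ℕP.<⇒≤ (ℕP.<-≤-trans b<t (ℕP.≤-trans (sink-r Π p) (right≤n Π p)))
  Block-bounds (suffix p t<a a≤r) = ℕP.≤-trans a≤r (ℕP.m≤n⇒m≤1+n (right≤n Π p)) , right≤n Π p

  RaisedOnBlock : (ℕ → ℚ) → Set
  RaisedOnBlock s = Σ ℕ λ a → Σ ℕ λ b → Block a b × regret s ≤ regret (raised P a b)

  Θk≡0⇒RaisedOnBlock : ∀ s → Θk P Π s ≡ 0ℚ → RaisedOnBlock s
  Θk≡0⇒RaisedOnBlock s Θk≡0 = suc n , n , none , Θk≡0⇒regret≤ {s} Θk≡0 (raised P (suc n) n)

  termL⇒RaisedOnBlock : ∀ s → IsScenario P s → ∀ p {j} → j ∈ upTo (sink Π p ∸ left Π p) →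
    Θk P Π s ≡ termL P s (left Π p) (sink Π p) j → RaisedOnBlock s
  termL⇒RaisedOnBlock s s-scen p {j} j∈ Θk≡term =
    l , i , blk , regret≤regret-raised s s-scen {l} {i} (ℕP.m≤m+n l j) (proj₂ (Block-bounds blk))
                    ((x P (sink Π p) - x P i) * τ P) Θk≡term (termL≤Θk P Π (raised P l i) p j∈)
    where
    l i : ℕ
    l = left Π p
    i = l ℕ.+ j
    i<t : i ℕ.< sink Π p
    i<t = subst (i ℕ.<_) (ℕP.m+[n∸m]≡n (sink-l Π p)) (ℕP.+-monoʳ-< l (∈-upTo⁻ j∈))
    blk : Block l i
    blk = prefix p (ℕP.m≤m+n l j) i<t

  termR⇒RaisedOnBlock : ∀ s → IsScenario P s → ∀ p {j} → j ∈ upTo (right Π p ∸ sink Π p) →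
    Θk P Π s ≡ termR P s (sink Π p) (right Π p) j → RaisedOnBlock s
  termR⇒RaisedOnBlock s s-scen p {j} j∈ Θk≡term =
    i , r , suffix p (s≤s (ℕP.m≤m+n t j)) i≤r ,
    regret≤regret-raised s s-scen {i} {r} i≤r (right≤n Π p)
      ((x P i - x P t) * τ P) Θk≡term (termR≤Θk P Π (raised P i r) p j∈)
    where
    t r i : ℕ
    t = sink Π p
    r = right Π p
    i = suc t ℕ.+ j
    i≤r : i ℕ.≤ r
    i≤r = subst (i ℕ.≤_) (ℕP.m+[n∸m]≡n (sink-r Π p)) (ℕP.+-monoʳ-< t (∈-upTo⁻ j∈))

  raiseOnBlock : ∀ s → IsScenario P s → RaisedOnBlock s
  raiseOnBlock s s-scen = case maxL-attained (ΘPart P Π s) (allFin k) of λ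
    { (inj₁ Θk≡0) → Θk≡0⇒RaisedOnBlock s Θk≡0
    ; (inj₂ (p , _ , Θk≡part)) → case ℚP.⊔-sel (ΘLPart P Π s p) (ΘRPart P Π s p) of λ
      { (inj₁ part≡L) → viaL p (trans {i = Θk P Π s} {j = ΘPart P Π s p} Θk≡part part≡L)
      ; (inj₂ part≡R) → viaR p (trans {i = Θk P Π s} {j = ΘPart P Π s p} Θk≡part part≡R) } }
    where
    viaL : ∀ p → Θk P Π s ≡ ΘLPart P Π s p → RaisedOnBlock s
    viaL p Θk≡L = case maxL-attained (termL P s (left Π p) (sink Π p)) (upTo (sink Π p ∸ left Π p)) of λ
      { (inj₁ L≡0) → Θk≡0⇒RaisedOnBlock s (trans {i = Θk P Π s} {j = ΘLPart P Π s p} Θk≡L L≡0)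
      ; (inj₂ (j , j∈ , L≡term)) →
          termL⇒RaisedOnBlock s s-scen p j∈ (trans {i = Θk P Π s} {j = ΘLPart P Π s p} Θk≡L L≡term) }
    viaR : ∀ p → Θk P Π s ≡ ΘRPart P Π s p → RaisedOnBlock s
    viaR p Θk≡R = case maxL-attained (termR P s (sink Π p) (right Π p)) (upTo (right Π p ∸ sink Π p)) of λ
      { (inj₁ R≡0) → Θk≡0⇒RaisedOnBlock s (trans {i = Θk P Π s} {j = ΘRPart P Π s p} Θk≡R R≡0)
      ; (inj₂ (j , j∈ , R≡term)) →
          termR⇒RaisedOnBlock s s-scen p j∈ (trans {i = Θk P Π s} {j = ΘRPart P Π s p} Θk≡R R≡term) }

  worstBlock : Σ ℕ λ a → Σ ℕ λ b →
    Block a b × (∀ s → IsScenario P s → regret s ≤ regret (raised P a b))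
  worstBlock = case raiseOnBlock (raised P a₀ b₀) (raised-isScenario P a₀ b₀) of λ
    { (a , b , blk , best≤) → a , b , blk , λ s s-scen → case raiseOnBlock s s-scen of λ
      { (a′ , b′ , blk′ , s≤) → ℚP.≤-trans s≤ (ℚP.≤-trans (≤best blk′) best≤) } }
    where
    open Extrema ℚ-totalOrder using (argmax; f[xs]≤f[argmax])
    regret-raised : ℕ × ℕ → ℚ
    regret-raised ab = regret (raised P (proj₁ ab) (proj₂ ab))
    candidates : List (ℕ × ℕ)
    candidates = cartesianProduct (upTo (suc (suc n))) (upTo (suc n))
    best : ℕ × ℕ
    best = argmax regret-raised (0 , 0) candidates
    a₀ b₀ : ℕ
    a₀ = proj₁ best
    b₀ = proj₂ best
    ≤best : ∀ {a b} → Block a b → regret (raised P a b) ≤ regret (raised P a₀ b₀)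
    ≤best {a} {b} blk = ListAll.lookup (f[xs]≤f[argmax] {f = regret-raised} (0 , 0) candidates) {a , b} ab∈
      where
      ab∈ : (a , b) ∈ candidates
      ab∈ = ∈-cartesianProduct⁺ (∈-upTo⁺ (s≤s (proj₁ (Block-bounds blk))))
                                (∈-upTo⁺ (s≤s (proj₂ (Block-bounds blk))))

  raised-w⁻-elsewhere : ∀ {a b} p d → p ≢ d →
    (∀ {j} → a ℕ.≤ j → j ℕ.≤ b → left Π p ℕ.≤ j × j ℕ.≤ right Π p) →
    ∀ j → left Π d ℕ.≤ j → j ℕ.≤ right Π d → raised P a b j ≡ w⁻ P j
  raised-w⁻-elsewhere {a} {b} p d p≢d ab⊆p j l≤j j≤r = raised-outside P {a} {b} {j} λ (a≤j , j≤b) →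
    let (lp≤j , j≤rp) = ab⊆p a≤j j≤b in p≢d (parts-disjoint Π lp≤j j≤rp l≤j j≤r)

  raised-dominant : ∀ {a b} → Block a b → ∀ d →
    LeftDominant P (raised P a b) (left Π d) (right Π d) ⊎ RightDominant P (raised P a b) (left Π d) (right Π d)
  raised-dominant none d = inj₁ (w⁻-on⇒LeftDominant P (left≤right Π d) λ j _ j≤r →
    raised-outside P {suc n} {n} {j} λ (1+n≤j , _) →
      ℕP.<⇒≱ (s≤s (ℕP.≤-trans j≤r (right≤n Π d))) 1+n≤j)
  raised-dominant (prefix p {b} l≤b b<t) d with p Fin.≟ d
  ... | yes refl = inj₁ (suc b , ℕP.m≤n⇒m≤1+n l≤b , ℕP.≤-trans b<t (sink-r Π p) ,
          (λ j l≤j j<1+b → raised-inside P {left Π p} {b} {j} l≤j (ℕP.≤-pred j<1+b)) ,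
          (λ j 1+b≤j _ → raised-outside P {left Π p} {b} {j} λ (_ , j≤b) →
            ℕP.<⇒≱ (s≤s j≤b) 1+b≤j))
  ... | no p≢d = inj₁ (w⁻-on⇒LeftDominant P (left≤right Π d)
          (raised-w⁻-elsewhere {left Π p} {b} p d p≢d λ l≤j j≤b →
            l≤j , ℕP.≤-trans j≤b (ℕP.≤-trans (ℕP.<⇒≤ b<t) (sink-r Π p))))
  raised-dominant (suffix p {a} t<a a≤r) d with p Fin.≟ d
  ... | yes refl = inj₂ (a , ℕP.≤-trans (sink-l Π p) (ℕP.<⇒≤ t<a) , a≤r ,
          (λ j _ j<a → raised-outside P {a} {right Π p} {j} λ (a≤j , _) → ℕP.<⇒≱ j<a a≤j) ,
          (λ j a≤j j≤r → raised-inside P {a} {right Π p} {j} a≤j j≤r))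
  ... | no p≢d = inj₁ (w⁻-on⇒LeftDominant P (left≤right Π d)
          (raised-w⁻-elsewhere {a} {right Π p} p d p≢d λ a≤j j≤r →
            ℕP.≤-trans (ℕP.≤-trans (sink-l Π p) (ℕP.<⇒≤ t<a)) a≤j , j≤r))

firstArgmax : ∀ {k} (g : Fin (suc k) → ℚ) →
  Σ (Fin (suc k)) λ d → (∀ i → g i ≤ g d) × (∀ i → toℕ i ℕ.< toℕ d → g i < g d)
firstArgmax {zero} g = Fin.zero , (λ { Fin.zero → ℚP.≤-refl }) , (λ _ ())
firstArgmax {suc k} g with firstArgmax (λ i → g (Fin.suc i))
... | d , g≤gd , g<gd with g (Fin.suc d) ℚP.≤? g Fin.zero
...   | yes gd≤g0 = Fin.zero ,
                    (λ { Fin.zero → ℚP.≤-refl ; (Fin.suc i) → ℚP.≤-trans (g≤gd i) gd≤g0 }) , (λ _ ())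
...   | no gd≰g0  = Fin.suc d ,
                    (λ { Fin.zero → ℚP.<⇒≤ g0<gd ; (Fin.suc i) → g≤gd i }) ,
                    (λ { Fin.zero _ → g0<gd ; (Fin.suc i) i<d → g<gd i (ℕP.≤-pred i<d) })
  where
  g0<gd : g Fin.zero < g (Fin.suc d)
  g0<gd = ℚP.≰⇒> gd≰g0

lemma2 : (n k : ℕ) (P : PathInstance n) (Π : KPartition n k) →
    Σ (ℕ → ℚ) λ s* → IsWorstCase P Π s* ×
      Σ (Fin k) λ d → IsDominant P Π s* d ×
        (LeftDominant P s* (left Π d) (right Π d) ⊎ RightDominant P s* (left Π d) (right Π d))
lemma2 n zero P Π with k-pos Π
... | ()
lemma2 n (suc k) P Π = case worstBlock of λ
  { (a , b , blk , maximal) → case firstArgmax (ΘPart P Π (raised P a b)) of λ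
    { (d , d-dominant) →
      raised P a b ,
      (raised-isScenario P a b , regret (raised P a b) , regret-isRegret (raised P a b) ,
       λ s s-scen r r-regret →
         subst (_≤ regret (raised P a b)) (sym (IsRegret⇒≡regret {s} {r} r-regret)) (maximal s s-scen)) ,
      d , d-dominant , raised-dominant blk d } }
  where open Regret P Π
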